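{- Let $N \in \mathbb{N}$, $k \ge 1$, $l \ge 1$, $Q = \pi'_N(k)$ and $n = Ql$. Let $0 \le m \le k-1$ and $0 \le t \le l-1$. Then for every integer $r$ with $Q - \binom{k+1-m}{2} + 1 \le r \le Q-1$, \[ [q^{mn + tQ + r}]\begin{bmatrix} n+k \\ k \end{bmatrix}_q \equiv 0 \pmod{N}. \] (Equivalently: writing the $m$-th section $\big([q^{mn+j}]\begin{bmatrix} n+k \\ k \end{bmatrix}_q\big)_{j=0}^{n-1}$ as a concatenation of $l$ consecutive blocks of length $Q$, the last $\binom{k+1-m}{2}-1$ entries of each block are $0$ modulo $N$.)
   Context: The Gaussian polynomial is $\begin{bmatrix} n \\ k \end{bmatrix}_q = \frac{[n]!}{[n-k]!\,[k]!}$ with $[m]! = \prod_{i=1}^{m} \frac{1-q^i}{1-q}$; $[q^\alpha]f$ is the coefficient of $q^\alpha$ in $f$. $p_{\le k}(n)$ is the number of partitions of $n$ with at most $k$ parts; $\pi_N(k)$ is the minimal period of the purely periodic sequence $(p_{\le k}(n)\bmod N)_{n\ge0}$ (so $\pi_N(1)=1$). Define $\pi'_N(1) = 1$ and for $k \ge 2$: $\pi'_N(k) = \frac{\pi_N(k)}{\pi_N(k-1)}\pi'_N(k-1)$ if $N$ divides $\frac{\pi_N(k)}{\pi_N(k-1)}$, and $\pi'_N(k) = N\frac{\pi_N(k)}{\pi_N(k-1)}\pi'_N(k-1)$ otherwise. -}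

module Defs where

open import Data.Nat using (ℕ; zero; suc; _+_; _*_; _∸_; _≤_; _<_; _⊓_; NonZero)
open import Data.Nat.DivMod using (_/_; _%_)
open import Data.Nat.Divisibility using (_∣?_)
open import Data.List using (List; map; upTo)
open import Data.Nat.ListAction using (sum)
open import Data.Bool using (if_then_else_)
open import Data.Product using (_×_)
open import Relation.Binary.PropositionalEquality using (_≡_)
open import Relation.Nullary using (¬_)
open import Relation.Nullary.Decidable using (⌊_⌋)

-- Formal power series / polynomials in q with ℕ coefficients,
-- represented by their coefficient sequences  ℕ → ℕ  (f i = [q^i] f).

Series : Set
Series = ℕ → ℕ

_⋆_ : Series → Series → Series
(f ⋆ g) i = sum (map (λ j → f j * g (i ∸ j)) (upTo (suc i)))

-- [m]_q = (1 - q^m)/(1 - q) = 1 + q + ... + q^{m-1}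
qint : ℕ → Series
qint m i with i Data.Nat.<ᵇ m
... | Data.Bool.true  = 1
... | Data.Bool.false = 0

one : Series
one zero    = 1
one (suc _) = 0

qfact : ℕ → Series
qfact zero    = one
qfact (suc m) = qfact m ⋆ qint (suc m)

-- G is the Gaussian polynomial [a choose b]_q = [a]! / ([a-b]! [b]!),
-- i.e. G * [a-b]! * [b]! = [a]!  (coefficientwise).  Since [a-b]![b]!
-- has constant term 1, this determines G uniquely.
IsGaussian : ℕ → ℕ → Series → Set
IsGaussian a b G = ∀ i → ((G ⋆ qfact (a ∸ b)) ⋆ qfact b) i ≡ qfact a i

-- cnt k n b = number of non-increasing lists of positive integers,
-- each ≤ b, of length ≤ k, summing to n  (recursion on the first part j).
cnt : ℕ → ℕ → ℕ → ℕ
cnt k       zero    b = 1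
cnt zero    (suc n) b = 0
cnt (suc k) (suc n) b =
  sum (map (λ i → cnt k (suc n ∸ suc i) (suc i)) (upTo (b ⊓ suc n)))

pLe : ℕ → ℕ → ℕ
pLe k n = cnt k n n

IsPeriod : (N : ℕ) .{{_ : NonZero N}} → ℕ → ℕ → Set
IsPeriod N k p = ∀ n → pLe k (n + p) % N ≡ pLe k n % N

IsMinPeriod : (N : ℕ) .{{_ : NonZero N}} → ℕ → ℕ → Set
IsMinPeriod N k p =
  (1 ≤ p) × IsPeriod N k p × (∀ p′ → 1 ≤ p′ → p′ < p → ¬ IsPeriod N k p′)

quot : ℕ → ℕ → ℕ
quot m zero    = 0
quot m (suc d) = m / suc d

-- π′_N(k) computed from a function π with π k = π_N(k)
π′ : ℕ → (ℕ → ℕ) → ℕ → ℕ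
π′ N π zero          = 1
π′ N π (suc zero)    = 1
π′ N π (suc (suc k)) =
  let ρ = quot (π (suc (suc k))) (π (suc k)) in
  if ⌊ N ∣? ρ ⌋ then ρ * π′ N π (suc k) else N * ρ * π′ N π (suc k)

-- [n+k choose k]_q = (1 - q^(n+1)) ⋯ (1 - q^(n+k)) · Σₐ p_{≤k}(a) qᵃ, so each coefficient is an
-- alternating sum of values of p_{≤k} at a minus sums of distinct n + i; in the m-th section,
-- mn ≤ a < (m+1)n, only the terms with at most m factors q^(n+i) reach a. Modulo N, p_{≤k} is
-- π_N(k)-periodic and π_N(k) divides both Q = π'_N(k) and n = Ql. Replacing p_{≤k} by its periodic
-- extension to ℤ, the n's can be dropped and a = mn + tQ + r can be moved to r - Q, where only
-- values at r - Q - j with j ≤ k + (k-1) + ⋯ + (k-m+1) remain. These lie in (-T, 0) for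
-- T = k(k+1)/2 and r in the given range, and the periodic extension vanishes modulo N on (-T, 0):
-- it agrees with p_{≤k} on ℕ, and (1 - q) ⋯ (1 - qᵏ) · Σₐ p_{≤k}(a) qᵃ = 1 determines its values
-- just below 0 from those above.

module Submission where

open import Defs
open import Data.Nat using (ℕ; zero; suc; _+_; _*_; _∸_; _≤_; _<_; _⊓_; z≤n; s≤s; _≤?_; NonZero)
import Data.Nat as ℕ
import Data.Nat.Properties as ℕ
open import Data.Nat.DivMod
  using (_%_; _/_; m≡m%n+[m/n]*n; [m+kn]%n≡m%n; [m+n]%n≡m%n; m%n<n; m<n⇒m%n≡m; m/n*n≡m)
open import Data.Nat.Divisibility as ℕ∣ using (_∣_)
open import Data.Nat.Combinatorics using (_C_; nC1≡n; nCk+nC[k+1]≡[n+1]C[k+1])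
open import Data.Nat.Induction using (<-rec)
open import Data.Nat.ListAction using (sum)
open import Data.Nat.ListAction.Properties using (sum-++)
open import Data.Nat.Tactic.RingSolver using () renaming (solve-∀ to solve-∀ℕ)
open import Data.Integer as ℤ using (ℤ; +_; -[1+_]; -_)
  renaming (_+_ to _+ℤ_; _-_ to _-ℤ_; _*_ to _*ℤ_; _≤_ to _≤ℤ_)
import Data.Integer.Properties as ℤ
import Data.Integer.Divisibility.Signed as ℤ∣
open import Data.Integer.Tactic.RingSolver using (solve-∀)
open import Data.List using (map; upTo; applyUpTo; _∷ʳ_)
open import Data.List.Properties using (map-upTo; applyUpTo-∷ʳ)
open import Data.Bool using (true; false; if_then_else_)
open import Data.Product using (_×_; _,_; proj₁; proj₂; ∃-syntax)
open import Data.Sum using (inj₁; inj₂)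
open import Data.Empty using (⊥-elim)
open import Function using (_∘_)
open import Relation.Nullary using (Dec; yes; no)
open import Relation.Nullary.Decidable using (⌊_⌋)
open import Relation.Binary.Bundles using (Setoid)
open import Relation.Binary.PropositionalEquality
  using (_≡_; refl; sym; trans; cong; cong₂; subst; _≗_; _→-setoid_; module ≡-Reasoning)
import Relation.Binary.Reasoning.Setoid as SetoidReasoning
open import Algebra.Properties.CommutativeSemigroup ℕ.+-commutativeSemigroup
  using (interchange; x∙yz≈y∙xz)

module ≗-Reasoning = SetoidReasoning (ℕ →-setoid ℕ)

≗-sym : {f g : Series} → f ≗ g → g ≗ f
≗-sym p i = sym (p i)

tail : Series → Series
tail f i = f (suc i)

infixl 7 _∗_
infixl 6 _⊕_

-- A structurally recursive Cauchy product, easier to reason about than _⋆_.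
_∗_ : Series → Series → Series
(f ∗ g) zero    = f 0 * g 0
(f ∗ g) (suc i) = f 0 * g (suc i) + (tail f ∗ g) i

_⊕_ : Series → Series → Series
(f ⊕ g) i = f i + g i

_·_ : ℕ → Series → Series
(c · f) i = c * f i

shift : ℕ → Series → Series
shift zero    f         = f
shift (suc c) f zero    = 0
shift (suc c) f (suc i) = shift c f i

⋆≗∗ : ∀ f g → f ⋆ g ≗ f ∗ g
⋆≗∗ f g i = trans (cong sum (map-upTo (λ j → f j * g (i ∸ j)) (suc i))) (sum≡∗ g i f)
  where
  sum≡∗ : ∀ g i f → sum (applyUpTo (λ j → f j * g (i ∸ j)) (suc i)) ≡ (f ∗ g) i
  sum≡∗ g zero    f = ℕ.+-identityʳ _
  sum≡∗ g (suc i) f = cong (_+_ (f 0 * g (suc i))) (sum≡∗ g i (tail f))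

∗-cong : ∀ {f f′ g g′} → f ≗ f′ → g ≗ g′ → f ∗ g ≗ f′ ∗ g′
∗-cong p q zero    = cong₂ _*_ (p 0) (q 0)
∗-cong p q (suc i) = cong₂ _+_ (cong₂ _*_ (p 0) (q (suc i))) (∗-cong (λ j → p (suc j)) q i)

∗-congˡ : ∀ {f f′} g → f ≗ f′ → f ∗ g ≗ f′ ∗ g
∗-congˡ g p = ∗-cong p (λ _ → refl)

∗-congʳ : ∀ f {g g′} → g ≗ g′ → f ∗ g ≗ f ∗ g′
∗-congʳ f = ∗-cong (λ _ → refl)

∗-unfoldʳ : ∀ f g i → (f ∗ g) (suc i) ≡ g 0 * f (suc i) + (f ∗ tail g) i
∗-unfoldʳ f g zero = trans (ℕ.+-comm (f 0 * g 1) _) (cong (_+ f 0 * g 1) (ℕ.*-comm (f 1) (g 0)))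
∗-unfoldʳ f g (suc i) = begin
  f 0 * g (2 + i) + (tail f ∗ g) (suc i)
    ≡⟨ cong (_+_ (f 0 * g (2 + i))) (∗-unfoldʳ (tail f) g i) ⟩
  f 0 * g (2 + i) + (g 0 * f (2 + i) + (tail f ∗ tail g) i)
    ≡⟨ x∙yz≈y∙xz (f 0 * g (2 + i)) (g 0 * f (2 + i)) _ ⟩
  g 0 * f (2 + i) + (f 0 * g (2 + i) + (tail f ∗ tail g) i) ∎
  where open ≡-Reasoning

∗-comm : ∀ f g → f ∗ g ≗ g ∗ f
∗-comm f g zero    = ℕ.*-comm (f 0) (g 0)
∗-comm f g (suc i) = trans (∗-unfoldʳ f g i) (cong (_+_ (g 0 * f (suc i))) (∗-comm f (tail g) i))

∗-identityˡ : ∀ g → one ∗ g ≗ g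
∗-identityˡ g zero    = ℕ.+-identityʳ _
∗-identityˡ g (suc i) = trans (cong₂ _+_ (ℕ.+-identityʳ _) (zero∗ i)) (ℕ.+-identityʳ _)
  where
  zero∗ : ∀ i → ((λ _ → 0) ∗ g) i ≡ 0
  zero∗ zero    = refl
  zero∗ (suc i) = zero∗ i

∗-identityʳ : ∀ g → g ∗ one ≗ g
∗-identityʳ g i = trans (∗-comm g one i) (∗-identityˡ g i)

∗-distribʳ-⊕ : ∀ f f′ g → (f ⊕ f′) ∗ g ≗ f ∗ g ⊕ f′ ∗ g
∗-distribʳ-⊕ f f′ g zero    = ℕ.*-distribʳ-+ (g 0) (f 0) (f′ 0)
∗-distribʳ-⊕ f f′ g (suc i) = begin
  (f 0 + f′ 0) * g (suc i) + ((tail f ⊕ tail f′) ∗ g) i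
    ≡⟨ cong₂ _+_ (ℕ.*-distribʳ-+ (g (suc i)) (f 0) (f′ 0)) (∗-distribʳ-⊕ (tail f) (tail f′) g i) ⟩
  (f 0 * g (suc i) + f′ 0 * g (suc i)) + ((tail f ∗ g) i + (tail f′ ∗ g) i)
    ≡⟨ interchange (f 0 * g (suc i)) _ _ _ ⟩
  (f 0 * g (suc i) + (tail f ∗ g) i) + (f′ 0 * g (suc i) + (tail f′ ∗ g) i) ∎
  where open ≡-Reasoning

∗-distribˡ-⊕ : ∀ f g g′ → f ∗ (g ⊕ g′) ≗ f ∗ g ⊕ f ∗ g′
∗-distribˡ-⊕ f g g′ i = begin
  (f ∗ (g ⊕ g′)) i          ≡⟨ ∗-comm f _ i ⟩
  ((g ⊕ g′) ∗ f) i          ≡⟨ ∗-distribʳ-⊕ g g′ f i ⟩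
  (g ∗ f) i + (g′ ∗ f) i    ≡⟨ cong₂ _+_ (∗-comm g f i) (∗-comm g′ f i) ⟩
  (f ∗ g) i + (f ∗ g′) i    ∎
  where open ≡-Reasoning

∗-·ˡ : ∀ c f g → (c · f) ∗ g ≗ c · (f ∗ g)
∗-·ˡ c f g zero    = ℕ.*-assoc c (f 0) (g 0)
∗-·ˡ c f g (suc i) =
  trans (cong₂ _+_ (ℕ.*-assoc c (f 0) (g (suc i))) (∗-·ˡ c (tail f) g i))
        (sym (ℕ.*-distribˡ-+ c (f 0 * g (suc i)) _))

∗-assoc : ∀ f g h → (f ∗ g) ∗ h ≗ f ∗ (g ∗ h)
∗-assoc f g h zero    = ℕ.*-assoc (f 0) (g 0) (h 0)
∗-assoc f g h (suc i) = begin
  (f 0 * g 0) * h (suc i) + ((f 0 · tail g ⊕ tail f ∗ g) ∗ h) i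
    ≡⟨ cong (_+_ ((f 0 * g 0) * h (suc i))) (∗-distribʳ-⊕ (f 0 · tail g) (tail f ∗ g) h i) ⟩
  (f 0 * g 0) * h (suc i) + (((f 0 · tail g) ∗ h) i + ((tail f ∗ g) ∗ h) i)
    ≡⟨ cong₂ (λ a b → (f 0 * g 0) * h (suc i) + (a + b)) (∗-·ˡ (f 0) (tail g) h i) (∗-assoc (tail f) g h i) ⟩
  (f 0 * g 0) * h (suc i) + (f 0 * (tail g ∗ h) i + (tail f ∗ (g ∗ h)) i)
    ≡⟨ sym (ℕ.+-assoc ((f 0 * g 0) * h (suc i)) _ _) ⟩
  ((f 0 * g 0) * h (suc i) + f 0 * (tail g ∗ h) i) + (tail f ∗ (g ∗ h)) i
    ≡⟨ cong (_+ (tail f ∗ (g ∗ h)) i)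
         (trans (cong (_+ f 0 * (tail g ∗ h) i) (ℕ.*-assoc (f 0) (g 0) (h (suc i))))
                (sym (ℕ.*-distribˡ-+ (f 0) (g 0 * h (suc i)) _))) ⟩
  f 0 * (g 0 * h (suc i) + (tail g ∗ h) i) + (tail f ∗ (g ∗ h)) i ∎
  where open ≡-Reasoning

shift-cong : ∀ c {f g} → f ≗ g → shift c f ≗ shift c g
shift-cong zero    p i       = p i
shift-cong (suc c) p zero    = refl
shift-cong (suc c) p (suc i) = shift-cong c p i

shift-below : ∀ c f {i} → i < c → shift c f i ≡ 0
shift-below (suc c) f {zero}  _         = refl
shift-below (suc c) f {suc i} (s≤s i<c) = shift-below c f i<c

shift-above : ∀ c f {i} → c ≤ i → shift c f i ≡ f (i ∸ c)
shift-above zero    f _         = refl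
shift-above (suc c) f (s≤s c≤i) = shift-above c f c≤i

∗-shiftˡ : ∀ c f g → shift c f ∗ g ≗ shift c (f ∗ g)
∗-shiftˡ zero    f g i       = refl
∗-shiftˡ (suc c) f g zero    = refl
∗-shiftˡ (suc c) f g (suc i) = ∗-shiftˡ c f g i

∗-shiftʳ : ∀ c f g → f ∗ shift c g ≗ shift c (f ∗ g)
∗-shiftʳ c f g i = begin
  (f ∗ shift c g) i    ≡⟨ ∗-comm f _ i ⟩
  (shift c g ∗ f) i    ≡⟨ ∗-shiftˡ c g f i ⟩
  shift c (g ∗ f) i    ≡⟨ shift-cong c (∗-comm g f) i ⟩
  shift c (f ∗ g) i    ∎
  where open ≡-Reasoning

qint-+ : ∀ a b → qint (a + b) ≗ qint a ⊕ shift a (qint b)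
qint-+ zero    b i       = refl
qint-+ (suc a) b zero    = refl
qint-+ (suc a) b (suc i) = qint-+ a b i

qfact-suc : ∀ m → qfact (suc m) ≗ qfact m ∗ qint (suc m)
qfact-suc m = ⋆≗∗ (qfact m) (qint (suc m))

qfact-constant : ∀ m → qfact m 0 ≡ 1
qfact-constant zero    = refl
qfact-constant (suc m) = trans (qfact-suc m 0) (trans (ℕ.*-identityʳ _) (qfact-constant m))

qfact-split : ∀ a b {m} → a + b ≡ suc m →
  qfact m ∗ qint a ⊕ shift a (qfact m ∗ qint b) ≗ qfact (suc m)
qfact-split a b {m} a+b≡1+m = begin
  qfact m ∗ qint a ⊕ shift a (qfact m ∗ qint b)  ≈⟨ (λ i → cong (_+_ _) (∗-shiftʳ a (qfact m) (qint b) i)) ⟨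
  qfact m ∗ qint a ⊕ qfact m ∗ shift a (qint b)  ≈⟨ ∗-distribˡ-⊕ (qfact m) _ _ ⟨
  qfact m ∗ (qint a ⊕ shift a (qint b))          ≈⟨ ∗-congʳ (qfact m) (qint-+ a b) ⟨
  qfact m ∗ qint (a + b)                         ≡⟨ cong (λ c → qfact m ∗ qint c) a+b≡1+m ⟩
  qfact m ∗ qint (suc m)                         ≈⟨ qfact-suc m ⟨
  qfact (suc m)                                  ∎
  where open ≗-Reasoning

∗-cancelʳ : ∀ {f f′} g → g 0 ≡ 1 → f ∗ g ≗ f′ ∗ g → f ≗ f′
∗-cancelʳ {f} {f′} g g₀≡1 eq i = agreeUpTo i i ℕ.≤-refl
  where
  ·g₀ : ∀ x → g 0 * x ≡ x
  ·g₀ x = trans (cong (_* x) g₀≡1) (ℕ.*-identityˡ x)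

  ∗-local : ∀ i {h h′} c → (∀ j → j ≤ i → h j ≡ h′ j) → (h ∗ c) i ≡ (h′ ∗ c) i
  ∗-local zero    c p = cong (_* c 0) (p 0 z≤n)
  ∗-local (suc i) c p = cong₂ _+_ (cong (_* c (suc i)) (p 0 z≤n))
    (∗-local i c (λ j j≤i → p (suc j) (s≤s j≤i)))

  agreeUpTo : ∀ i j → j ≤ i → f j ≡ f′ j
  agreeUpTo zero .zero z≤n =
    trans (sym (·g₀ (f 0))) (trans (trans (ℕ.*-comm (g 0) _) (eq 0)) (trans (ℕ.*-comm _ (g 0)) (·g₀ (f′ 0))))
  agreeUpTo (suc i) j j≤1+i with ℕ.m≤n⇒m<n∨m≡n j≤1+i
  ... | inj₁ (s≤s j≤i) = agreeUpTo i j j≤i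
  ... | inj₂ refl      = ℕ.+-cancelʳ-≡ _ _ _ (begin
    f (suc i) + (f ∗ tail g) i               ≡⟨ cong (_+ (f ∗ tail g) i) (·g₀ (f (suc i))) ⟨
    g 0 * f (suc i) + (f ∗ tail g) i         ≡⟨ ∗-unfoldʳ f g i ⟨
    (f ∗ g) (suc i)                          ≡⟨ eq (suc i) ⟩
    (f′ ∗ g) (suc i)                         ≡⟨ ∗-unfoldʳ f′ g i ⟩
    g 0 * f′ (suc i) + (f′ ∗ tail g) i
      ≡⟨ cong₂ _+_ (·g₀ (f′ (suc i))) (sym (∗-local i (tail g) (agreeUpTo i))) ⟩
    f′ (suc i) + (f ∗ tail g) i              ∎)
    where open ≡-Reasoning

⊕-cong : ∀ {f f′ g g′} → f ≗ f′ → g ≗ g′ → f ⊕ g ≗ f′ ⊕ g′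
⊕-cong p q i = cong₂ _+_ (p i) (q i)

infixr 8 [_]![_]!·_
[_]![_]!·_ : ℕ → ℕ → Series → Series
[ n ]![ k ]!· f = (f ∗ qfact n) ∗ qfact k

[]![]!-⊕ : ∀ n k f g → [ n ]![ k ]!· (f ⊕ g) ≗ [ n ]![ k ]!· f ⊕ [ n ]![ k ]!· g
[]![]!-⊕ n k f g i = trans (∗-congˡ (qfact k) (∗-distribʳ-⊕ f g (qfact n)) i) (∗-distribʳ-⊕ _ _ (qfact k) i)

[]![]!-shift : ∀ n k c f → [ n ]![ k ]!· shift c f ≗ shift c ([ n ]![ k ]!· f)
[]![]!-shift n k c f i = trans (∗-congˡ (qfact k) (∗-shiftˡ c f (qfact n)) i) (∗-shiftˡ c _ (qfact k) i)

[]![]!-sucʳ : ∀ n k f → [ n ]![ suc k ]!· f ≗ ([ n ]![ k ]!· f) ∗ qint (suc k)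
[]![]!-sucʳ n k f = begin
  (f ∗ qfact n) ∗ qfact (suc k)              ≈⟨ ∗-congʳ (f ∗ qfact n) (qfact-suc k) ⟩
  (f ∗ qfact n) ∗ (qfact k ∗ qint (suc k))   ≈⟨ ∗-assoc (f ∗ qfact n) _ _ ⟨
  ((f ∗ qfact n) ∗ qfact k) ∗ qint (suc k)   ∎
  where open ≗-Reasoning

[]![]!-sucˡ : ∀ n k f → [ suc n ]![ k ]!· f ≗ ([ n ]![ k ]!· f) ∗ qint (suc n)
[]![]!-sucˡ n k f = begin
  (f ∗ qfact (suc n)) ∗ qfact k              ≈⟨ ∗-congˡ (qfact k) (∗-congʳ f (qfact-suc n)) ⟩
  (f ∗ (qfact n ∗ qint (suc n))) ∗ qfact k   ≈⟨ ∗-congˡ (qfact k) (∗-assoc f _ _) ⟨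
  ((f ∗ qfact n) ∗ qint (suc n)) ∗ qfact k   ≈⟨ ∗-assoc (f ∗ qfact n) _ _ ⟩
  (f ∗ qfact n) ∗ (qint (suc n) ∗ qfact k)   ≈⟨ ∗-congʳ (f ∗ qfact n) (∗-comm (qint (suc n)) _) ⟩
  (f ∗ qfact n) ∗ (qfact k ∗ qint (suc n))   ≈⟨ ∗-assoc (f ∗ qfact n) _ _ ⟨
  ((f ∗ qfact n) ∗ qfact k) ∗ qint (suc n)   ∎
  where open ≗-Reasoning

[]![]!-cancel : ∀ n k {f f′} → [ n ]![ k ]!· f ≗ [ n ]![ k ]!· f′ → f ≗ f′
[]![]!-cancel n k eq =
  ∗-cancelʳ (qfact n) (qfact-constant n) (∗-cancelʳ (qfact k) (qfact-constant k) eq)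

box : ℕ → ℕ → Series
box k n i = cnt k i n

sumUpTo-suc : ∀ g c → sum (map g (upTo (suc c))) ≡ sum (map g (upTo c)) + g c
sumUpTo-suc g c = begin
  sum (map g (upTo (suc c)))          ≡⟨ cong sum (map-upTo g (suc c)) ⟩
  sum (applyUpTo g (suc c))           ≡⟨ cong sum (applyUpTo-∷ʳ g c) ⟨
  sum (applyUpTo g c ∷ʳ g c)          ≡⟨ sum-++ (applyUpTo g c) _ ⟩
  sum (applyUpTo g c) + (g c + 0)     ≡⟨ cong₂ _+_ (cong sum (map-upTo g c)) (sym (ℕ.+-identityʳ (g c))) ⟨
  sum (map g (upTo c)) + g c          ∎
  where open ≡-Reasoning

-- Either every part is at most n, or the largest part is n + 1 and removing it leaves
-- a partition into at most k parts.
box-pascal₁ : ∀ k n → box (suc k) (suc n) ≗ box (suc k) n ⊕ shift (suc n) (box k (suc n))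
box-pascal₁ k n zero    = refl
box-pascal₁ k n (suc a) = byLargestPart (n ≤? a)
  where
  open ≡-Reasoning
  withLargestPart : ℕ → ℕ
  withLargestPart i = cnt k (suc a ∸ suc i) (suc i)
  largestPartBelow : ℕ → ℕ
  largestPartBelow c = sum (map withLargestPart (upTo c))
  byLargestPart : Dec (n ≤ a) →
    largestPartBelow (suc n ⊓ suc a) ≡ largestPartBelow (n ⊓ suc a) + shift n (box k (suc n)) a
  byLargestPart (yes n≤a) = begin
    largestPartBelow (suc n ⊓ suc a)            ≡⟨ cong largestPartBelow (ℕ.m≤n⇒m⊓n≡m (s≤s n≤a)) ⟩
    largestPartBelow (suc n)                    ≡⟨ sumUpTo-suc withLargestPart n ⟩
    largestPartBelow n + withLargestPart n      ≡⟨ cong₂ _+_ (cong largestPartBelow (ℕ.m≤n⇒m⊓n≡m (ℕ.m≤n⇒m≤1+n n≤a)))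
                                                             (shift-above n (box k (suc n)) n≤a) ⟨
    largestPartBelow (n ⊓ suc a) + shift n (box k (suc n)) a ∎
  byLargestPart (no  n≰a) = begin
    largestPartBelow (suc n ⊓ suc a)            ≡⟨ cong largestPartBelow (ℕ.m≥n⇒m⊓n≡n (s≤s (ℕ.<⇒≤ a<n))) ⟩
    largestPartBelow (suc a)                    ≡⟨ ℕ.+-identityʳ _ ⟨
    largestPartBelow (suc a) + 0                ≡⟨ cong₂ _+_ (cong largestPartBelow (ℕ.m≥n⇒m⊓n≡n a<n))
                                                             (shift-below n (box k (suc n)) a<n) ⟨
    largestPartBelow (n ⊓ suc a) + shift n (box k (suc n)) a ∎
    where a<n = ℕ.≰⇒> n≰a

box-zeroˡ : ∀ n → box 0 n ≗ one
box-zeroˡ n zero    = refl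
box-zeroˡ n (suc i) = refl

box-zeroʳ : ∀ k → box k 0 ≗ one
box-zeroʳ zero    = box-zeroˡ 0
box-zeroʳ (suc k) zero    = refl
box-zeroʳ (suc k) (suc i) = refl

box-gaussian : ∀ k n → [ n ]![ k ]!· box k n ≗ qfact (n + k)
box-gaussian zero n = begin
  (box 0 n ∗ qfact n) ∗ one      ≈⟨ ∗-identityʳ _ ⟩
  box 0 n ∗ qfact n              ≈⟨ ∗-congˡ (qfact n) (box-zeroˡ n) ⟩
  one ∗ qfact n                  ≈⟨ ∗-identityˡ (qfact n) ⟩
  qfact n                        ≡⟨ cong qfact (ℕ.+-identityʳ n) ⟨
  qfact (n + 0)                  ∎
  where open ≗-Reasoning
box-gaussian (suc k) zero = begin
  (box (suc k) 0 ∗ one) ∗ qfact (suc k)   ≈⟨ ∗-congˡ (qfact (suc k)) (∗-identityʳ _) ⟩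
  box (suc k) 0 ∗ qfact (suc k)           ≈⟨ ∗-congˡ (qfact (suc k)) (box-zeroʳ (suc k)) ⟩
  one ∗ qfact (suc k)                     ≈⟨ ∗-identityˡ (qfact (suc k)) ⟩
  qfact (suc k)                           ∎
  where open ≗-Reasoning
box-gaussian (suc k) (suc n) = begin
  [ suc n ]![ suc k ]!· box (suc k) (suc n)
    ≈⟨ ∗-congˡ (qfact (suc k)) (∗-congˡ (qfact (suc n)) (box-pascal₁ k n)) ⟩
  [ suc n ]![ suc k ]!· (box (suc k) n ⊕ shift (suc n) (box k (suc n)))
    ≈⟨ []![]!-⊕ (suc n) (suc k) _ _ ⟩
  [ suc n ]![ suc k ]!· box (suc k) n ⊕ [ suc n ]![ suc k ]!· shift (suc n) (box k (suc n))
    ≈⟨ ⊕-cong ([]![]!-sucˡ n (suc k) _) ([]![]!-shift (suc n) (suc k) (suc n) _) ⟩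
  ([ n ]![ suc k ]!· box (suc k) n) ∗ qint (suc n) ⊕ shift (suc n) ([ suc n ]![ suc k ]!· box k (suc n))
    ≈⟨ ⊕-cong (∗-congˡ (qint (suc n)) (box-gaussian (suc k) n))
              (shift-cong (suc n) (λ i → trans ([]![]!-sucʳ (suc n) k _ i)
                                               (∗-congˡ (qint (suc k)) (box-gaussian k (suc n)) i))) ⟩
  qfact (n + suc k) ∗ qint (suc n) ⊕ shift (suc n) (qfact (suc n + k) ∗ qint (suc k))
    ≡⟨ cong (λ c → qfact (n + suc k) ∗ qint (suc n) ⊕ shift (suc n) (qfact c ∗ qint (suc k))) (ℕ.+-suc n k) ⟨
  qfact (n + suc k) ∗ qint (suc n) ⊕ shift (suc n) (qfact (n + suc k) ∗ qint (suc k))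
    ≈⟨ qfact-split (suc n) (suc k) refl ⟩
  qfact (suc n + suc k) ∎
  where open ≗-Reasoning

IsGaussian⇒box : ∀ k n G → IsGaussian (n + k) k G → G ≗ box k n
IsGaussian⇒box k n G isGaussian = []![]!-cancel n k (begin
  (G ∗ qfact n) ∗ qfact k                   ≡⟨ cong (λ c → (G ∗ qfact c) ∗ qfact k) (ℕ.m+n∸n≡m n k) ⟨
  (G ∗ qfact (n + k ∸ k)) ∗ qfact k         ≈⟨ ∗-congˡ (qfact k) (⋆≗∗ G _) ⟨
  (G ⋆ qfact (n + k ∸ k)) ∗ qfact k         ≈⟨ ⋆≗∗ _ (qfact k) ⟨
  (G ⋆ qfact (n + k ∸ k)) ⋆ qfact k         ≈⟨ isGaussian ⟩
  qfact (n + k)                             ≈⟨ box-gaussian k n ⟨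
  [ n ]![ k ]!· box k n                     ∎)
  where open ≗-Reasoning

box-pascal₂ : ∀ k n → box (suc k) (suc n) ≗ box k (suc n) ⊕ shift (suc k) (box (suc k) n)
box-pascal₂ k n = ≗-sym ([]![]!-cancel (suc n) (suc k) (begin
  [ suc n ]![ suc k ]!· (box k (suc n) ⊕ shift (suc k) (box (suc k) n))
    ≈⟨ []![]!-⊕ (suc n) (suc k) _ _ ⟩
  [ suc n ]![ suc k ]!· box k (suc n) ⊕ [ suc n ]![ suc k ]!· shift (suc k) (box (suc k) n)
    ≈⟨ ⊕-cong ([]![]!-sucʳ (suc n) k _) ([]![]!-shift (suc n) (suc k) (suc k) _) ⟩
  ([ suc n ]![ k ]!· box k (suc n)) ∗ qint (suc k) ⊕ shift (suc k) ([ suc n ]![ suc k ]!· box (suc k) n)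
    ≈⟨ ⊕-cong (∗-congˡ (qint (suc k)) (box-gaussian k (suc n)))
              (shift-cong (suc k) (λ i → trans ([]![]!-sucˡ n (suc k) _ i)
                                               (∗-congˡ (qint (suc n)) (box-gaussian (suc k) n) i))) ⟩
  qfact (suc n + k) ∗ qint (suc k) ⊕ shift (suc k) (qfact (n + suc k) ∗ qint (suc n))
    ≡⟨ cong (λ c → qfact (suc n + k) ∗ qint (suc k) ⊕ shift (suc k) (qfact c ∗ qint (suc n))) (ℕ.+-suc n k) ⟩
  qfact (suc n + k) ∗ qint (suc k) ⊕ shift (suc k) (qfact (suc n + k) ∗ qint (suc n))
    ≈⟨ qfact-split (suc k) (suc n) (cong suc (ℕ.+-comm k (suc n))) ⟩
  qfact (suc (suc n + k))
    ≡⟨ cong (qfact ∘ suc) (ℕ.+-suc n k) ⟨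
  qfact (suc n + suc k)
    ≈⟨ box-gaussian (suc k) (suc n) ⟨
  [ suc n ]![ suc k ]!· box (suc k) (suc n) ∎))
  where open ≗-Reasoning

shift-congᵢ : ∀ c {f g} i → (c ≤ i → f (i ∸ c) ≡ g (i ∸ c)) → shift c f i ≡ shift c g i
shift-congᵢ c {f} {g} i p with c ≤? i
... | yes c≤i = trans (shift-above c f c≤i) (trans (p c≤i) (sym (shift-above c g c≤i)))
... | no  c≰i = trans (shift-below c f (ℕ.≰⇒> c≰i)) (sym (shift-below c g (ℕ.≰⇒> c≰i)))

box≡pLe : ∀ k {n a} → a ≤ n → box k n a ≡ pLe k a
box≡pLe k       {a = zero}  _   = refl
box≡pLe zero    {a = suc a} _   = refl
box≡pLe (suc k) {n} {suc a} a≤n =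
  cong (λ c → sum (map (λ i → cnt k (suc a ∸ suc i) (suc i)) (upTo c)))
       (trans (ℕ.m≥n⇒m⊓n≡n a≤n) (sym (ℕ.⊓-idem (suc a))))

pLe-suc : ∀ k a → pLe (suc k) a ≡ pLe k a + shift (suc k) (pLe (suc k)) a
pLe-suc k zero    = refl
pLe-suc k (suc a) = trans (box-pascal₂ k a (suc a)) (cong (_+_ (pLe k (suc a)))
  (shift-congᵢ (suc k) (suc a) (λ _ → box≡pLe (suc k) (ℕ.m∸n≤m a k))))

Seq : Set
Seq = ℤ → ℤ

Δ : ℕ → Seq → Seq
Δ d h x = h x -ℤ h (x -ℤ + d)

-- With (Eᶜ h) x = h (x - c):  ∇ n k = (1 - E^(n+1)) ⋯ (1 - E^(n+k)).
∇ : ℕ → ℕ → Seq → Seq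
∇ n zero    h x = h x
∇ n (suc k) h x = ∇ n k h x -ℤ ∇ n k h (x -ℤ + (n + suc k))

-- ∇< m and ∇≥ m are the parts of the expanded product ∇ n k made of the terms with
-- fewer than m, respectively at least m, factors E^(n+i).
∇< : ℕ → ℕ → ℕ → Seq → Seq
∇< zero    n k       h x = + 0
∇< (suc m) n zero    h x = h x
∇< (suc m) n (suc k) h x = ∇< (suc m) n k h x -ℤ ∇< m n k h (x -ℤ + (n + suc k))

∇≥ : ℕ → ℕ → ℕ → Seq → Seq
∇≥ zero    n k       h x = ∇ n k h x
∇≥ (suc m) n zero    h x = + 0
∇≥ (suc m) n (suc k) h x = ∇≥ (suc m) n k h x -ℤ ∇≥ m n k h (x -ℤ + (n + suc k))

-ℤ-+ : ∀ x a b → x -ℤ + a -ℤ + b ≡ x -ℤ + (a + b)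
-ℤ-+ x a b = trans (lemma x (+ a) (+ b)) (cong (x -ℤ_) (sym (ℤ.pos-+ a b)))
  where
  lemma : ∀ x a b → x -ℤ a -ℤ b ≡ x -ℤ (a +ℤ b)
  lemma = solve-∀

∇-cong : ∀ n k {h h′} → h ≗ h′ → ∇ n k h ≗ ∇ n k h′
∇-cong n zero    p x = p x
∇-cong n (suc k) p x = cong₂ _-ℤ_ (∇-cong n k p x) (∇-cong n k p _)

∇-translate : ∀ n k h c x → ∇ n k h (x +ℤ c) ≡ ∇ n k (λ y → h (y +ℤ c)) x
∇-translate n zero    h c x = refl
∇-translate n (suc k) h c x = cong₂ _-ℤ_ (∇-translate n k h c x)
  (trans (cong (∇ n k h) (lemma x c (+ (n + suc k)))) (∇-translate n k h c _))
  where
  lemma : ∀ x c d → (x +ℤ c) -ℤ d ≡ (x -ℤ d) +ℤ c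
  lemma = solve-∀

∇-periodic : ∀ n k h c → (∀ y → h (y +ℤ c) ≡ h y) → ∀ x → ∇ n k h (x +ℤ c) ≡ ∇ n k h x
∇-periodic n k h c per x = trans (∇-translate n k h c x) (∇-cong n k per x)

∇-Δ : ∀ n k d h x → ∇ n k (Δ d h) x ≡ Δ d (∇ n k h) x
∇-Δ n k d h x = trans (∇-linear k x)
  (cong (∇ n k h x -ℤ_) (sym (∇-translate n k h (- + d) x)))
  where
  ∇-linear : ∀ k x → ∇ n k (Δ d h) x ≡ ∇ n k h x -ℤ ∇ n k (λ y → h (y -ℤ + d)) x
  ∇-linear zero    x = refl
  ∇-linear (suc k) x = trans (cong₂ _-ℤ_ (∇-linear k x) (∇-linear k x′))
    (lemma (∇ n k h x) (∇ n k h′ x) (∇ n k h x′) (∇ n k h′ x′))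
    where
    x′ = x -ℤ + (n + suc k)
    h′ = λ y → h (y -ℤ + d)
    lemma : ∀ a b c e → (a -ℤ b) -ℤ (c -ℤ e) ≡ (a -ℤ c) -ℤ (b -ℤ e)
    lemma = solve-∀

∇-peel : ∀ n k h x → ∇ n (suc k) h x ≡ ∇ (suc n) k (Δ (suc n) h) x
∇-peel n zero    h x = cong (λ c → h x -ℤ h (x -ℤ + c)) (ℕ.+-comm n 1)
∇-peel n (suc k) h x = cong₂ _-ℤ_ (∇-peel n k h x)
  (trans (cong (λ c → ∇ n (suc k) h (x -ℤ + c)) (ℕ.+-suc n (suc k))) (∇-peel n k h _))

∇-pascal : ∀ n k h x →
  ∇ (suc n) (suc k) h x ≡ ∇ n (suc k) h x +ℤ ∇ (suc n) k (Δ (suc k) h) (x -ℤ + suc n)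
∇-pascal n k h x = begin
  u x -ℤ u (x -ℤ + (suc n + suc k))
    ≡⟨ cong (λ y → u x -ℤ u y) (-ℤ-+ x (suc n) (suc k)) ⟨
  u x -ℤ u (x -ℤ + suc n -ℤ + suc k)
    ≡⟨ lemma (u x) (u (x -ℤ + suc n)) _ ⟩
  (u x -ℤ u (x -ℤ + suc n)) +ℤ (u (x -ℤ + suc n) -ℤ u (x -ℤ + suc n -ℤ + suc k))
    ≡⟨ cong₂ _+ℤ_ (trans (∇-peel n k h x) (∇-Δ (suc n) k (suc n) h x)) (∇-Δ (suc n) k (suc k) h _) ⟨
  ∇ n (suc k) h x +ℤ ∇ (suc n) k (Δ (suc k) h) (x -ℤ + suc n) ∎
  where
  open ≡-Reasoning
  u = ∇ (suc n) k h
  lemma : ∀ a b c → a -ℤ c ≡ (a -ℤ b) +ℤ (b -ℤ c)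
  lemma = solve-∀

∇-split : ∀ m n k h x → ∇ n k h x ≡ ∇< m n k h x +ℤ ∇≥ m n k h x
∇-split zero    n k       h x = sym (ℤ.+-identityˡ _)
∇-split (suc m) n zero    h x = sym (ℤ.+-identityʳ _)
∇-split (suc m) n (suc k) h x =
  trans (cong₂ _-ℤ_ (∇-split (suc m) n k h x) (∇-split m n k h x′))
        (lemma (∇< (suc m) n k h x) (∇≥ (suc m) n k h x) (∇< m n k h x′) (∇≥ m n k h x′))
  where
  x′ = x -ℤ + (n + suc k)
  lemma : ∀ a b c e → (a +ℤ b) -ℤ (c +ℤ e) ≡ (a -ℤ c) +ℤ (b -ℤ e)
  lemma = solve-∀

∇≥≡∇-∇< : ∀ m n k h x → ∇≥ m n k h x ≡ ∇ n k h x -ℤ ∇< m n k h x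
∇≥≡∇-∇< m n k h x = trans (lemma (∇< m n k h x) _) (cong (_-ℤ ∇< m n k h x) (sym (∇-split m n k h x)))
  where
  lemma : ∀ a b → b ≡ (a +ℤ b) -ℤ a
  lemma = solve-∀

∇<≡∇-∇≥ : ∀ m n k h x → ∇< m n k h x ≡ ∇ n k h x -ℤ ∇≥ m n k h x
∇<≡∇-∇≥ m n k h x = trans (lemma _ (∇≥ m n k h x)) (cong (_-ℤ ∇≥ m n k h x) (sym (∇-split m n k h x)))
  where
  lemma : ∀ a b → a ≡ (a +ℤ b) -ℤ b
  lemma = solve-∀

∇-vanish : ∀ n k h x → (∀ j → h (x -ℤ + j) ≡ + 0) → ∇ n k h x ≡ + 0
∇-vanish n zero    h x p = trans (cong h (sym (ℤ.+-identityʳ x))) (p 0)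
∇-vanish n (suc k) h x p = cong₂ _-ℤ_ (∇-vanish n k h x p)
  (∇-vanish n k h _ (λ j → trans (cong h (-ℤ-+ x (n + suc k) j)) (p _)))

+-regroup : ∀ n k m t → n + suc k + (m * n + t) ≡ suc m * n + (suc k + t)
+-regroup = solve-∀ℕ

∇≥-vanish : ∀ m n k h x → (∀ j → h (x -ℤ + (m * n + j)) ≡ + 0) → ∇≥ m n k h x ≡ + 0
∇≥-vanish zero    n k       h x p = ∇-vanish n k h x p
∇≥-vanish (suc m) n zero    h x p = refl
∇≥-vanish (suc m) n (suc k) h x p = cong₂ _-ℤ_ (∇≥-vanish (suc m) n k h x p)
  (∇≥-vanish m n k h _ (λ j → trans (cong h (shifts j)) (p (suc k + j))))
  where
  shifts : ∀ j → x -ℤ + (n + suc k) -ℤ + (m * n + j) ≡ x -ℤ + (suc m * n + (suc k + j))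
  shifts j = trans (-ℤ-+ x (n + suc k) (m * n + j)) (cong (λ c → x -ℤ + c) (+-regroup n k m j))

∇≥-tooMany : ∀ m n k h x → k < m → ∇≥ m n k h x ≡ + 0
∇≥-tooMany (suc m) n zero    h x _         = refl
∇≥-tooMany (suc m) n (suc k) h x (s≤s k<m) =
  cong₂ _-ℤ_ (∇≥-tooMany (suc m) n k h x (ℕ.m<n⇒m<1+n k<m)) (∇≥-tooMany m n k h _ k<m)

topSum : ℕ → ℕ → ℕ
topSum zero    m       = 0
topSum (suc k) zero    = 0
topSum (suc k) (suc m) = suc k + topSum k m

triangle : ℕ → ℕ
triangle k = topSum k k

[-1]^ : ℕ → ℤ
[-1]^ zero    = + 1
[-1]^ (suc k) = - [-1]^ k

∇≥-top : ∀ k h x → ∇≥ k 0 k h x ≡ [-1]^ k *ℤ h (x -ℤ + triangle k)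
∇≥-top zero    h x = trans (cong h (sym (ℤ.+-identityʳ x))) (sym (ℤ.*-identityˡ _))
∇≥-top (suc k) h x = begin
  ∇≥ (suc k) 0 k h x -ℤ ∇≥ k 0 k h (x -ℤ + suc k)
    ≡⟨ cong₂ _-ℤ_ (∇≥-tooMany (suc k) 0 k h x (ℕ.n<1+n k)) (∇≥-top k h _) ⟩
  + 0 -ℤ [-1]^ k *ℤ h (x -ℤ + suc k -ℤ + triangle k)
    ≡⟨ cong (λ y → + 0 -ℤ [-1]^ k *ℤ h y) (-ℤ-+ x (suc k) (triangle k)) ⟩
  + 0 -ℤ [-1]^ k *ℤ h (x -ℤ + triangle (suc k))
    ≡⟨ lemma ([-1]^ k) _ ⟩
  [-1]^ (suc k) *ℤ h (x -ℤ + triangle (suc k)) ∎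
  where
  open ≡-Reasoning
  lemma : ∀ a b → + 0 -ℤ a *ℤ b ≡ (- a) *ℤ b
  lemma = solve-∀

[-1]^-square : ∀ k → [-1]^ k *ℤ [-1]^ k ≡ + 1
[-1]^-square zero    = refl
[-1]^-square (suc k) = trans (lemma ([-1]^ k)) ([-1]^-square k)
  where
  lemma : ∀ s → (- s) *ℤ (- s) ≡ s *ℤ s
  lemma = solve-∀

∇<-cong : ∀ m n k {h h′} → h ≗ h′ → ∇< m n k h ≗ ∇< m n k h′
∇<-cong zero    n k       p x = refl
∇<-cong (suc m) n zero    p x = p x
∇<-cong (suc m) n (suc k) p x = cong₂ _-ℤ_ (∇<-cong (suc m) n k p x) (∇<-cong m n k p _)

∇<-translate : ∀ m n k h c x → ∇< m n k h (x +ℤ c) ≡ ∇< m n k (λ y → h (y +ℤ c)) x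
∇<-translate zero    n k       h c x = refl
∇<-translate (suc m) n zero    h c x = refl
∇<-translate (suc m) n (suc k) h c x = cong₂ _-ℤ_ (∇<-translate (suc m) n k h c x)
  (trans (cong (∇< m n k h) (lemma x c (+ (n + suc k)))) (∇<-translate m n k h c _))
  where
  lemma : ∀ x c d → (x +ℤ c) -ℤ d ≡ (x -ℤ d) +ℤ c
  lemma = solve-∀

∇<-periodic : ∀ m n k h c → (∀ y → h (y +ℤ c) ≡ h y) → ∀ x → ∇< m n k h (x +ℤ c) ≡ ∇< m n k h x
∇<-periodic m n k h c per x = trans (∇<-translate m n k h c x) (∇<-cong m n k per x)

∇<-dropPeriod : ∀ m n k h → (∀ y → h (y +ℤ - + n) ≡ h y) → ∀ x → ∇< m n k h x ≡ ∇< m 0 k h x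
∇<-dropPeriod zero    n k       h per x = refl
∇<-dropPeriod (suc m) n zero    h per x = refl
∇<-dropPeriod (suc m) n (suc k) h per x = cong₂ _-ℤ_ (∇<-dropPeriod (suc m) n k h per x) (begin
  ∇< m n k h (x -ℤ + (n + suc k))          ≡⟨ ∇<-dropPeriod m n k h per _ ⟩
  ∇< m 0 k h (x -ℤ + (n + suc k))          ≡⟨ cong (∇< m 0 k h) (reassoc x n (suc k)) ⟩
  ∇< m 0 k h ((x -ℤ + suc k) +ℤ - + n)     ≡⟨ ∇<-periodic m 0 k h (- + n) per _ ⟩
  ∇< m 0 k h (x -ℤ + suc k)                ∎)
  where
  open ≡-Reasoning
  lemma : ∀ x a b → x -ℤ a -ℤ b ≡ (x -ℤ b) +ℤ - a
  lemma = solve-∀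
  reassoc : ∀ x a b → x -ℤ + (a + b) ≡ (x -ℤ + b) +ℤ - + a
  reassoc x a b = trans (sym (-ℤ-+ x a b)) (lemma x (+ a) (+ b))

∇<-zero : ∀ m n k x → ∇< m n k (λ _ → + 0) x ≡ + 0
∇<-zero zero    n k       x = refl
∇<-zero (suc m) n zero    x = refl
∇<-zero (suc m) n (suc k) x = cong₂ _-ℤ_ (∇<-zero (suc m) n k x) (∇<-zero m n k _)

toSeq : Series → Seq
toSeq f (+ a)    = + f a
toSeq f -[1+ a ] = + 0

toSeq-cong : ∀ {f g} → f ≗ g → toSeq f ≗ toSeq g
toSeq-cong p (+ a)    = cong +_ (p a)
toSeq-cong p -[1+ a ] = refl

toSeq-⊕ : ∀ f g x → toSeq (f ⊕ g) x ≡ toSeq f x +ℤ toSeq g x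
toSeq-⊕ f g (+ a)    = ℤ.pos-+ (f a) (g a)
toSeq-⊕ f g -[1+ a ] = refl

toSeq-negative : ∀ f {z} → 0 < z → toSeq f (- + z) ≡ + 0
toSeq-negative f {suc z} _ = refl

+-ℤ+-≥ : ∀ {a b} → b ≤ a → + a -ℤ + b ≡ + (a ∸ b)
+-ℤ+-≥ {a} {b} b≤a = trans (ℤ.[+m]-[+n]≡m⊖n a b) (ℤ.⊖-≥ b≤a)

+-ℤ+-< : ∀ {a b} → a < b → + a -ℤ + b ≡ - + (b ∸ a)
+-ℤ+-< {a} {b} a<b = trans (ℤ.[+m]-[+n]≡m⊖n a b) (ℤ.⊖-< a<b)

-+-ℤ+ : ∀ a b → - + a -ℤ + b ≡ - + (a + b)
-+-ℤ+ a b = trans (lemma (+ a) (+ b)) (cong -_ (sym (ℤ.pos-+ a b)))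
  where
  lemma : ∀ a b → - a -ℤ b ≡ - (a +ℤ b)
  lemma = solve-∀

toSeq-shift : ∀ c f x → toSeq (shift c f) x ≡ toSeq f (x -ℤ + c)
toSeq-shift c f -[1+ a ] = cong (toSeq f) (sym (ℤ.neg-minus-pos a c))
toSeq-shift c f (+ a) with c ≤? a
... | yes c≤a = trans (cong +_ (shift-above c f c≤a))
  (cong (toSeq f) (sym (+-ℤ+-≥ c≤a)))
... | no c≰a = trans (cong +_ (shift-below c f a<c)) (sym (begin
  toSeq f (+ a -ℤ + c)      ≡⟨ cong (toSeq f) (+-ℤ+-< a<c) ⟩
  toSeq f (- + (c ∸ a))     ≡⟨ toSeq-negative f (ℕ.m<n⇒0<n∸m a<c) ⟩
  + 0                       ∎))
  where
  open ≡-Reasoning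
  a<c = ℕ.≰⇒> c≰a

p≤ : ℕ → Seq
p≤ k = toSeq (pLe k)

p≤-below : ∀ k {a b} → a < b → p≤ k (+ a -ℤ + b) ≡ + 0
p≤-below k a<b = trans (cong (p≤ k) (+-ℤ+-< a<b)) (toSeq-negative (pLe k) (ℕ.m<n⇒0<n∸m a<b))

p≤-negative : ∀ k {i} → 1 ≤ i → p≤ k (- + i) ≡ + 0
p≤-negative k = toSeq-negative (pLe k)

p≤-Δ : ∀ k → p≤ k ≗ Δ (suc k) (p≤ (suc k))
p≤-Δ k x = begin
  p≤ k x                                              ≡⟨ lemma (p≤ k x) _ ⟩
  (p≤ k x +ℤ toSeq (shift (suc k) (pLe (suc k))) x) -ℤ toSeq (shift (suc k) (pLe (suc k))) x
    ≡⟨ cong₂ _-ℤ_ (trans (toSeq-cong (pLe-suc k) x) (toSeq-⊕ (pLe k) _ x))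
                  (sym (toSeq-shift (suc k) (pLe (suc k)) x)) ⟨
  Δ (suc k) (p≤ (suc k)) x                            ∎
  where
  open ≡-Reasoning
  lemma : ∀ a b → a ≡ (a +ℤ b) -ℤ b
  lemma = solve-∀

δ : Seq
δ = toSeq one

δ-positive : ∀ {y} → 1 ≤ y → δ (+ y) ≡ + 0
δ-positive {suc y} _ = refl

p≤-zero : p≤ 0 ≗ δ
p≤-zero (+ zero)  = refl
p≤-zero (+ suc a) = refl
p≤-zero -[1+ a ]  = refl

∇-p≤ : ∀ k → ∇ 0 k (p≤ k) ≗ δ
∇-p≤ zero            = p≤-zero
∇-p≤ (suc k) x = begin
  ∇ 0 (suc k) (p≤ (suc k)) x               ≡⟨ ∇-Δ 0 k (suc k) (p≤ (suc k)) x ⟨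
  ∇ 0 k (Δ (suc k) (p≤ (suc k))) x         ≡⟨ ∇-cong 0 k (p≤-Δ k) x ⟨
  ∇ 0 k (p≤ k) x                           ≡⟨ ∇-p≤ k x ⟩
  δ x                                      ∎
  where open ≡-Reasoning

box≗∇p≤ : ∀ k n → toSeq (box k n) ≗ ∇ n k (p≤ k)
box≗∇p≤ zero    n (+ zero)  = refl
box≗∇p≤ zero    n (+ suc a) = refl
box≗∇p≤ zero    n -[1+ a ]  = refl
box≗∇p≤ (suc k) zero    x   = trans (toSeq-cong (box-zeroʳ (suc k)) x) (sym (∇-p≤ (suc k) x))
box≗∇p≤ (suc k) (suc n) x   = begin
  toSeq (box (suc k) (suc n)) x
    ≡⟨ toSeq-cong (box-pascal₁ k n) x ⟩
  toSeq (box (suc k) n ⊕ shift (suc n) (box k (suc n))) x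
    ≡⟨ toSeq-⊕ _ _ x ⟩
  toSeq (box (suc k) n) x +ℤ toSeq (shift (suc n) (box k (suc n))) x
    ≡⟨ cong₂ _+ℤ_ (box≗∇p≤ (suc k) n x) (trans (toSeq-shift (suc n) _ x) (box≗∇p≤ k (suc n) _)) ⟩
  ∇ n (suc k) (p≤ (suc k)) x +ℤ ∇ (suc n) k (p≤ k) (x -ℤ + suc n)
    ≡⟨ cong (∇ n (suc k) (p≤ (suc k)) x +ℤ_) (∇-cong (suc n) k (p≤-Δ k) _) ⟩
  ∇ n (suc k) (p≤ (suc k)) x +ℤ ∇ (suc n) k (Δ (suc k) (p≤ (suc k))) (x -ℤ + suc n)
    ≡⟨ ∇-pascal n k (p≤ (suc k)) x ⟨
  ∇ (suc n) (suc k) (p≤ (suc k)) x ∎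
  where open ≡-Reasoning

topSum-mono : ∀ k m → topSum k m ≤ topSum (suc k) m
topSum-mono zero    m       = z≤n
topSum-mono (suc k) zero    = z≤n
topSum-mono (suc k) (suc m) = s≤s (ℕ.+-mono-≤ (ℕ.n≤1+n k) (topSum-mono k m))

triangle-C : ∀ k → (k + 1) C 2 ≡ triangle k
triangle-C zero    = refl
triangle-C (suc k) = begin
  suc (k + 1) C 2             ≡⟨ nCk+nC[k+1]≡[n+1]C[k+1] (k + 1) 1 ⟨
  (k + 1) C 1 + (k + 1) C 2   ≡⟨ cong₂ _+_ (trans (nC1≡n (k + 1)) (ℕ.+-comm k 1)) (triangle-C k) ⟩
  suc k + triangle k          ∎
  where open ≡-Reasoning

topSum+C≡triangle : ∀ k m → m ≤ k → topSum k m + (k + 1 ∸ m) C 2 ≡ triangle k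
topSum+C≡triangle zero    zero    _         = refl
topSum+C≡triangle (suc k) zero    _         = triangle-C (suc k)
topSum+C≡triangle (suc k) (suc m) (s≤s m≤k) =
  trans (ℕ.+-assoc (suc k) (topSum k m) _) (cong (_+_ (suc k)) (topSum+C≡triangle k m m≤k))

C≤triangle : ∀ k m → m ≤ k → (k + 1 ∸ m) C 2 ≤ triangle k
C≤triangle k m m≤k = subst ((k + 1 ∸ m) C 2 ≤_) (topSum+C≡triangle k m m≤k) (ℕ.m≤n+m _ (topSum k m))

∸+topSum<triangle : ∀ {Q ρ} k m → m ≤ k → ρ ≤ Q → Q < ρ + (k + 1 ∸ m) C 2 →
                    Q ∸ ρ + topSum k m < triangle k
∸+topSum<triangle {Q} {ρ} k m m≤k ρ≤Q Q<ρ+C =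
  subst (Q ∸ ρ + topSum k m <_) (trans (ℕ.+-comm _ (topSum k m)) (topSum+C≡triangle k m m≤k))
    (ℕ.+-monoˡ-< (topSum k m) (subst (Q ∸ ρ <_) (ℕ.m+n∸m≡n ρ _) (ℕ.∸-monoˡ-< Q<ρ+C ρ≤Q)))

topSum<triangle : ∀ k → topSum (suc k) k < triangle (suc k)
topSum<triangle k = subst (topSum (suc k) k <_) (topSum+C≡triangle (suc k) k (ℕ.n≤1+n k))
  (subst (λ c → topSum (suc k) k < topSum (suc k) k + c C 2) (sym two)
         (ℕ.≤-reflexive (ℕ.+-comm 1 (topSum (suc k) k))))
  where
  two : suc k + 1 ∸ k ≡ 2
  two = trans (cong (_∸ k) (sym (ℕ.+-suc k 1))) (ℕ.m+n∸m≡n k 2)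

module Congruence (N : ℕ) where

  infix 4 _≈_
  record _≈_ (x y : ℤ) : Set where
    constructor mk≈
    field N∣x-y : + N ℤ∣.∣ (x -ℤ y)
  open _≈_

  ≈-by : ∀ {x y e} → e ≡ x -ℤ y → + N ℤ∣.∣ e → x ≈ y
  ≈-by refl N∣e = mk≈ N∣e

  ≈-reflexive : ∀ {x y} → x ≡ y → x ≈ y
  ≈-reflexive {x} refl = ≈-by (sym (ℤ.+-inverseʳ x)) (ℤ∣.divides (+ 0) (sym (ℤ.*-zeroˡ (+ N))))

  ≈-sym : ∀ {x y} → x ≈ y → y ≈ x
  ≈-sym {x} {y} x≈y = ≈-by (lemma x y) (ℤ∣.∣m⇒∣-m (N∣x-y x≈y))
    where
    lemma : ∀ x y → - (x -ℤ y) ≡ y -ℤ x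
    lemma = solve-∀

  ≈-trans : ∀ {x y z} → x ≈ y → y ≈ z → x ≈ z
  ≈-trans {x} {y} {z} x≈y y≈z = ≈-by (lemma x y z) (ℤ∣.∣m∣n⇒∣m+n (N∣x-y x≈y) (N∣x-y y≈z))
    where
    lemma : ∀ x y z → (x -ℤ y) +ℤ (y -ℤ z) ≡ x -ℤ z
    lemma = solve-∀

  ≈-setoid : Setoid _ _
  ≈-setoid = record
    { Carrier = ℤ ; _≈_ = _≈_
    ; isEquivalence = record { refl = ≈-reflexive refl ; sym = ≈-sym ; trans = ≈-trans } }

  module ≈-Reasoning = SetoidReasoning ≈-setoid

  +ℤ-cong : ∀ {a b c d} → a ≈ b → c ≈ d → a +ℤ c ≈ b +ℤ d
  +ℤ-cong {a} {b} {c} {d} a≈b c≈d = ≈-by (lemma a b c d) (ℤ∣.∣m∣n⇒∣m+n (N∣x-y a≈b) (N∣x-y c≈d))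
    where
    lemma : ∀ a b c d → (a -ℤ b) +ℤ (c -ℤ d) ≡ (a +ℤ c) -ℤ (b +ℤ d)
    lemma = solve-∀

  -ℤ-cong : ∀ {a b c d} → a ≈ b → c ≈ d → a -ℤ c ≈ b -ℤ d
  -ℤ-cong {a} {b} {c} {d} a≈b c≈d = ≈-by (lemma a b c d) (ℤ∣.∣m∣n⇒∣m-n (N∣x-y a≈b) (N∣x-y c≈d))
    where
    lemma : ∀ a b c d → (a -ℤ b) -ℤ (c -ℤ d) ≡ (a -ℤ c) -ℤ (b -ℤ d)
    lemma = solve-∀

  *ℤ-congˡ : ∀ s {a b} → a ≈ b → s *ℤ a ≈ s *ℤ b
  *ℤ-congˡ s {a} {b} a≈b = ≈-by (lemma s a b) (ℤ∣.∣n⇒∣m*n s (N∣x-y a≈b))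
    where
    lemma : ∀ s a b → s *ℤ (a -ℤ b) ≡ s *ℤ a -ℤ s *ℤ b
    lemma = solve-∀

  [-1]^-cancel : ∀ k {a} → [-1]^ k *ℤ a ≈ + 0 → a ≈ + 0
  [-1]^-cancel k {a} ±a≈0 = ≈-trans (≈-reflexive (sym unsign))
    (≈-trans (*ℤ-congˡ ([-1]^ k) ±a≈0) (≈-reflexive (ℤ.*-zeroʳ ([-1]^ k))))
    where
    unsign : [-1]^ k *ℤ ([-1]^ k *ℤ a) ≡ a
    unsign = trans (sym (ℤ.*-assoc ([-1]^ k) ([-1]^ k) a))
                   (trans (cong (_*ℤ a) ([-1]^-square k)) (ℤ.*-identityˡ a))

  ≈0⇒∣ : ∀ {a} → + a ≈ + 0 → N ∣ a
  ≈0⇒∣ {a} a≈0 = subst (N ∣_) (cong ℤ.∣_∣ (ℤ.+-identityʳ (+ a))) (ℤ∣.∣⇒∣ᵤ (N∣x-y a≈0))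

  %-≡⇒≈ : ∀ {a b} .{{_ : NonZero N}} → a % N ≡ b % N → + a ≈ + b
  %-≡⇒≈ {a} {b} eq = ≈-by difference (ℤ∣.∣m⇒∣m*n (+ (a / N) -ℤ + (b / N)) ℤ∣.∣-refl)
    where
    split : ∀ x → + x ≡ + (x % N) +ℤ + (x / N) *ℤ + N
    split x = trans (cong +_ (m≡m%n+[m/n]*n x N))
      (trans (ℤ.pos-+ (x % N) (x / N * N)) (cong (_+ℤ_ (+ (x % N))) (ℤ.pos-* (x / N) N)))
    lemma : ∀ r qa qb n → n *ℤ (qa -ℤ qb) ≡ (r +ℤ qa *ℤ n) -ℤ (r +ℤ qb *ℤ n)
    lemma = solve-∀
    difference : + N *ℤ (+ (a / N) -ℤ + (b / N)) ≡ + a -ℤ + b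
    difference = trans (lemma (+ (a % N)) (+ (a / N)) (+ (b / N)) (+ N))
      (sym (cong₂ _-ℤ_ (split a) (trans (split b) (cong (λ r → + r +ℤ + (b / N) *ℤ + N) (sym eq)))))

  ≈⇒%-≡-≥ : ∀ {a b} .{{_ : NonZero N}} → b ≤ a → + a ≈ + b → a % N ≡ b % N
  ≈⇒%-≡-≥ {a} {b} b≤a a≈b = begin
    a % N                               ≡⟨ cong (_% N) (ℕ.m+[n∸m]≡n b≤a) ⟨
    (b + (a ∸ b)) % N                   ≡⟨ cong (λ c → (b + c) % N) (ℕ∣.m∣n⇒n≡quotient*m N∣a-b) ⟩
    (b + ℕ∣.quotient N∣a-b * N) % N     ≡⟨ [m+kn]%n≡m%n b (ℕ∣.quotient N∣a-b) N ⟩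
    b % N                               ∎
    where
    open ≡-Reasoning
    N∣a-b : N ∣ (a ∸ b)
    N∣a-b = subst (N ∣_) (cong ℤ.∣_∣ (+-ℤ+-≥ b≤a)) (ℤ∣.∣⇒∣ᵤ (N∣x-y a≈b))

  ≈⇒%-≡ : ∀ {a b} .{{_ : NonZero N}} → + a ≈ + b → a % N ≡ b % N
  ≈⇒%-≡ {a} {b} a≈b with b ≤? a
  ... | yes b≤a = ≈⇒%-≡-≥ b≤a a≈b
  ... | no  b≰a = sym (≈⇒%-≡-≥ (ℕ.<⇒≤ (ℕ.≰⇒> b≰a)) (≈-sym a≈b))

  ≈-at : ∀ (h h′ : Seq) {x y} → x ≡ y → h y ≈ h′ y → h x ≈ h′ x
  ≈-at h h′ refl h≈h′ = h≈h′

  ∇<-window : ∀ m n k h h′ x → (∀ j → j ≤ m * n + topSum k m → h (x -ℤ + j) ≈ h′ (x -ℤ + j)) →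
              ∇< (suc m) n k h x ≈ ∇< (suc m) n k h′ x
  ∇<-window m n zero h h′ x agree = ≈-at h h′ (sym (ℤ.+-identityʳ x)) (agree 0 z≤n)
  ∇<-window m n (suc k) h h′ x agree = -ℤ-cong
    (∇<-window m n k h h′ x (λ j j≤ →
       agree j (ℕ.≤-trans j≤ (ℕ.+-monoʳ-≤ (m * n) (topSum-mono k m)))))
    (fewerShifts m agree)
    where
    fewerShifts : ∀ m → (∀ j → j ≤ m * n + topSum (suc k) m → h (x -ℤ + j) ≈ h′ (x -ℤ + j)) →
                  ∇< m n k h (x -ℤ + (n + suc k)) ≈ ∇< m n k h′ (x -ℤ + (n + suc k))
    fewerShifts zero    _     = ≈-reflexive refl
    fewerShifts (suc m) agree = ∇<-window m n k h h′ _ (λ j j≤ → ≈-at h h′ (-ℤ-+ x (n + suc k) j)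
      (agree (n + suc k + j) (ℕ.≤-trans (ℕ.+-monoʳ-≤ (n + suc k) j≤) (ℕ.≤-reflexive (+-regroup n k m (topSum k m))))))

  ∇-window : ∀ k h h′ x → (∀ j → j ≤ triangle k → h (x -ℤ + j) ≈ h′ (x -ℤ + j)) →
             ∇ 0 k h x ≈ ∇ 0 k h′ x
  ∇-window k h h′ x agree = begin
    ∇ 0 k h x                                          ≡⟨ ∇-split (suc k) 0 k h x ⟩
    ∇< (suc k) 0 k h x +ℤ ∇≥ (suc k) 0 k h x
      ≈⟨ +ℤ-cong window (≈-reflexive (trans (noTerms h) (sym (noTerms h′)))) ⟩
    ∇< (suc k) 0 k h′ x +ℤ ∇≥ (suc k) 0 k h′ x         ≡⟨ ∇-split (suc k) 0 k h′ x ⟨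
    ∇ 0 k h′ x                                         ∎
    where
    open ≈-Reasoning
    noTerms : ∀ g → ∇≥ (suc k) 0 k g x ≡ + 0
    noTerms g = ∇≥-tooMany (suc k) 0 k g x (ℕ.n<1+n k)
    window : ∇< (suc k) 0 k h x ≈ ∇< (suc k) 0 k h′ x
    window = ∇<-window k 0 k h h′ x (λ j j≤ → agree j (subst (j ≤_) (cong (_+ triangle k) (ℕ.*-zeroʳ k)) j≤))

  ≈p≤-shifted : ∀ k f {b} → (∀ a → f (+ a) ≈ p≤ k (+ a)) → (∀ {i} → 1 ≤ i → i < b → f (- + i) ≈ + 0) →
                ∀ y j → j < y + b → f (+ y -ℤ + j) ≈ p≤ k (+ y -ℤ + j)
  ≈p≤-shifted k f f≈p≤ f-vanishes y j j<y+b with j ≤? y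
  ... | yes j≤y = ≈-at f (p≤ k) (+-ℤ+-≥ j≤y) (f≈p≤ (y ∸ j))
  ... | no  j≰y = ≈-at f (p≤ k) (+-ℤ+-< y<j)
    (≈-trans (f-vanishes (ℕ.m<n⇒0<n∸m y<j)
                         (subst (j ∸ y <_) (ℕ.m+n∸m≡n y _) (ℕ.∸-monoˡ-< j<y+b (ℕ.<⇒≤ y<j))))
             (≈-reflexive (sym (p≤-negative k (ℕ.m<n⇒0<n∸m y<j)))))
    where y<j = ℕ.≰⇒> j≰y

  -- Induction on i: at T - i, the expansion of ∇ 0 k f is ±f(-i) plus values of f above -i,
  -- where f agrees with p_{≤k} by induction, and ∇ 0 k p_{≤k} = δ vanishes there.
  vanishing-below : ∀ k f → (∀ a → f (+ a) ≈ p≤ k (+ a)) → (∀ y → 1 ≤ y → ∇ 0 k f (+ y) ≈ + 0) →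
                    ∀ {i} → 1 ≤ i → i < triangle k → f (- + i) ≈ + 0
  vanishing-below zero    f f≈p≤ ∇f≈0 _ ()
  vanishing-below (suc k) f f≈p≤ ∇f≈0 {i} = <-rec (λ i → 1 ≤ i → i < triangle K → f (- + i) ≈ + 0) step i
    where
    K = suc k
    step : ∀ i → (∀ {i′} → i′ < i → 1 ≤ i′ → i′ < triangle K → f (- + i′) ≈ + 0) →
           1 ≤ i → i < triangle K → f (- + i) ≈ + 0
    step i IH 1≤i i<T = [-1]^-cancel K (begin
      [-1]^ K *ℤ f (- + i)                     ≡⟨ cong (λ z → [-1]^ K *ℤ f z) y-T≡-i ⟨
      [-1]^ K *ℤ f (+ y -ℤ + triangle K)       ≡⟨ ∇≥-top K f (+ y) ⟨
      ∇≥ K 0 K f (+ y)                         ≡⟨ ∇≥≡∇-∇< K 0 K f (+ y) ⟩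
      ∇ 0 K f (+ y) -ℤ ∇< K 0 K f (+ y)
        ≈⟨ -ℤ-cong (∇f≈0 y 1≤y) (∇<-window k 0 K f (p≤ K) (+ y) agree) ⟩
      + 0 -ℤ ∇< K 0 K (p≤ K) (+ y)
        ≡⟨ cong (+ 0 -ℤ_) (trans (∇<≡∇-∇≥ K 0 K (p≤ K) (+ y)) ∇p≤-∇≥p≤≡0) ⟩
      + 0 -ℤ + 0                               ∎)
      where
      open ≈-Reasoning
      y = triangle K ∸ i
      1≤y : 1 ≤ y
      1≤y = ℕ.m<n⇒0<n∸m i<T
      y-T≡-i : + y -ℤ + triangle K ≡ - + i
      y-T≡-i = trans (+-ℤ+-< (ℕ.∸-monoʳ-< 1≤i (ℕ.<⇒≤ i<T)))
                     (cong (λ c → - + c) (ℕ.m∸[m∸n]≡n (ℕ.<⇒≤ i<T)))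
      agree : ∀ j → j ≤ k * 0 + topSum K k → f (+ y -ℤ + j) ≈ p≤ K (+ y -ℤ + j)
      agree j j≤ = ≈p≤-shifted K f f≈p≤ (λ 1≤i′ i′<i → IH i′<i 1≤i′ (ℕ.<-trans i′<i i<T)) y j
        (subst (j <_) (sym (ℕ.m∸n+n≡m (ℕ.<⇒≤ i<T)))
               (ℕ.≤-<-trans (subst (j ≤_) (cong (_+ topSum K k) (ℕ.*-zeroʳ k)) j≤) (topSum<triangle k)))
      ∇p≤-∇≥p≤≡0 : ∇ 0 K (p≤ K) (+ y) -ℤ ∇≥ K 0 K (p≤ K) (+ y) ≡ + 0
      ∇p≤-∇≥p≤≡0 = cong₂ _-ℤ_ (trans (∇-p≤ K (+ y)) (δ-positive 1≤y))
        (trans (∇≥-top K (p≤ K) (+ y))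
               (trans (cong (λ z → [-1]^ K *ℤ p≤ K z) y-T≡-i)
                      (trans (cong ([-1]^ K *ℤ_) (p≤-negative K 1≤i)) (ℤ.*-zeroʳ ([-1]^ K)))))

IsPeriod-* : ∀ {N k p} .{{_ : NonZero N}} → IsPeriod N k p → ∀ c → IsPeriod N k (c * p)
IsPeriod-* {N} {k} {p} per zero    n = cong (λ a → pLe k a % N) (ℕ.+-identityʳ n)
IsPeriod-* {N} {k} {p} per (suc c) n = begin
  pLe k (n + (p + c * p)) % N    ≡⟨ cong (λ a → pLe k a % N) (ℕ.+-comm n (p + c * p)) ⟩
  pLe k ((p + c * p) + n) % N    ≡⟨ cong (λ a → pLe k a % N) (trans (ℕ.+-assoc p (c * p) n) (ℕ.+-comm p _)) ⟩
  pLe k ((c * p + n) + p) % N    ≡⟨ per (c * p + n) ⟩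
  pLe k (c * p + n) % N          ≡⟨ cong (λ a → pLe k a % N) (ℕ.+-comm (c * p) n) ⟩
  pLe k (n + c * p) % N          ≡⟨ IsPeriod-* per c n ⟩
  pLe k n % N                    ∎
  where open ≡-Reasoning

IsPeriod-∸ : ∀ {N k p r} .{{_ : NonZero N}} → IsPeriod N k p → IsPeriod N k (r + p) → IsPeriod N k r
IsPeriod-∸ {N} {k} {p} {r} per-p per-r+p n =
  trans (sym (per-p (n + r))) (trans (cong (λ a → pLe k a % N) (ℕ.+-assoc n r p)) (per-r+p n))

IsMinPeriod⇒∣ : ∀ {N k π p} .{{_ : NonZero N}} → IsMinPeriod N k π → IsPeriod N k p → π ∣ p
IsMinPeriod⇒∣ {N} {k} {π} {p} (1≤π , per-π , minimal) per-p = byRemainder (p % π ℕ.≟ 0)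
  where
  instance
    _ : NonZero π
    _ = ℕ.>-nonZero 1≤π
  per-p%π : IsPeriod N k (p % π)
  per-p%π = IsPeriod-∸ (IsPeriod-* per-π (p / π)) (subst (IsPeriod N k) (m≡m%n+[m/n]*n p π) per-p)
  byRemainder : Dec (p % π ≡ 0) → π ∣ p
  byRemainder (yes p%π≡0) = ℕ∣.m%n≡0⇒n∣m p π p%π≡0
  byRemainder (no  p%π≢0) = ⊥-elim (minimal (p % π) (ℕ.n≢0⇒n>0 p%π≢0) (m%n<n p π) per-p%π)

module PeriodicExtension (N : ℕ) .{{_ : NonZero N}} (k π : ℕ) .{{_ : NonZero π}} (per : IsPeriod N k π) where
  open Congruence N

  periodic : Seq
  periodic (+ a)    = + pLe k (a % π)
  periodic -[1+ a ] = + pLe k (π ∸ suc (a % π))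

  periodic-+π : ∀ y → periodic (y +ℤ + π) ≡ periodic y
  periodic-+π (+ a) = cong (λ r → + pLe k r) ([m+n]%n≡m%n a π)
  periodic-+π -[1+ a ] with suc a ≤? π
  ... | yes a<π = trans (cong periodic (ℤ.⊖-≥ a<π)) (cong (λ r → + pLe k r)
    (trans (m<n⇒m%n≡m (ℕ.∸-monoʳ-< (s≤s z≤n) a<π)) (cong (λ r → π ∸ suc r) (sym (m<n⇒m%n≡m a<π)))))
  ... | no  a≮π =
    trans (cong periodic (trans (ℤ.⊖-< (ℕ.≰⇒> a≮π)) (cong (λ c → - + c) (ℕ.+-∸-assoc 1 π≤a))))
    (cong (λ r → + pLe k (π ∸ suc r))
      (trans (sym ([m+n]%n≡m%n (a ∸ π) π)) (cong (_% π) (ℕ.m∸n+n≡m π≤a))))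
    where π≤a = ℕ.≤-pred (ℕ.≰⇒> a≮π)

  periodic-+* : ∀ c y → periodic (y +ℤ + (c * π)) ≡ periodic y
  periodic-+* zero    y = cong periodic (ℤ.+-identityʳ y)
  periodic-+* (suc c) y = begin
    periodic (y +ℤ + (π + c * π))           ≡⟨ cong periodic (cong (y +ℤ_) (ℤ.pos-+ π (c * π))) ⟩
    periodic (y +ℤ (+ π +ℤ + (c * π)))      ≡⟨ cong periodic (lemma y (+ π) (+ (c * π))) ⟩
    periodic ((y +ℤ + (c * π)) +ℤ + π)      ≡⟨ periodic-+π _ ⟩
    periodic (y +ℤ + (c * π))               ≡⟨ periodic-+* c y ⟩
    periodic y                              ∎
    where
    open ≡-Reasoning
    lemma : ∀ y a b → y +ℤ (a +ℤ b) ≡ (y +ℤ b) +ℤ a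
    lemma = solve-∀

  periodic-+∣ : ∀ {d} → π ∣ d → ∀ y → periodic (y +ℤ + d) ≡ periodic y
  periodic-+∣ (ℕ∣.divides c refl) = periodic-+* c

  periodic--∣ : ∀ {d} → π ∣ d → ∀ y → periodic (y +ℤ - + d) ≡ periodic y
  periodic--∣ {d} π∣d y = trans (sym (periodic-+∣ π∣d _)) (cong periodic (lemma y (+ d)))
    where
    lemma : ∀ y d → (y +ℤ - d) +ℤ d ≡ y
    lemma = solve-∀

  periodic≈p≤ : ∀ a → periodic (+ a) ≈ p≤ k (+ a)
  periodic≈p≤ a = %-≡⇒≈ (sym (trans (cong (λ b → pLe k b % N) (m≡m%n+[m/n]*n a π))
                                    (IsPeriod-* per (a / π) (a % π))))

  ∇-periodic≈0 : ∀ y → 1 ≤ y → ∇ 0 k periodic (+ y) ≈ + 0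
  ∇-periodic≈0 y 1≤y = begin
    ∇ 0 k periodic (+ y)                     ≡⟨ ∇-periodic 0 k periodic _ (periodic-+* (triangle k)) (+ y) ⟨
    ∇ 0 k periodic (+ y +ℤ + (triangle k * π)) ≈⟨ ∇-window k periodic (p≤ k) _ agree ⟩
    ∇ 0 k (p≤ k) (+ (y + triangle k * π))    ≡⟨ ∇-p≤ k _ ⟩
    δ (+ (y + triangle k * π))               ≡⟨ δ-positive (ℕ.≤-trans 1≤y (ℕ.m≤m+n y _)) ⟩
    + 0                                      ∎
    where
    open ≈-Reasoning
    Y = y + triangle k * π
    agree : ∀ j → j ≤ triangle k → periodic (+ Y -ℤ + j) ≈ p≤ k (+ Y -ℤ + j)
    agree j j≤T = ≈-at periodic (p≤ k) (+-ℤ+-≥ j≤Y) (periodic≈p≤ (Y ∸ j))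
      where
      j≤Y : j ≤ Y
      j≤Y = ℕ.≤-trans j≤T (ℕ.≤-trans (ℕ.m≤m*n (triangle k) π) (ℕ.m≤n+m _ y))

  periodic-vanishes : ∀ {i} → 1 ≤ i → i < triangle k → periodic (- + i) ≈ + 0
  periodic-vanishes = vanishing-below k periodic periodic≈p≤ ∇-periodic≈0

  periodic≈p≤-shifted : ∀ y j → j < y + triangle k → periodic (+ y -ℤ + j) ≈ p≤ k (+ y -ℤ + j)
  periodic≈p≤-shifted = ≈p≤-shifted k periodic periodic≈p≤ periodic-vanishes

  -- Otherwise 1 = p_{≤k}(0) ≡ periodic(-π) ≡ 0 modulo N.
  triangle≤period : 2 ≤ N → triangle k ≤ π
  triangle≤period 2≤N with triangle k ≤? π
  ... | yes T≤π = T≤π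
  ... | no  T≰π = ⊥-elim (ℕ.<⇒≱ 2≤N (ℕ.≤-reflexive (ℕ∣.∣1⇒≡1 (≈0⇒∣ 1≈0))))
    where
    1≤π : 1 ≤ π
    1≤π = ℕ.>-nonZero⁻¹ π
    1≈0 : + 1 ≈ + 0
    1≈0 = ≈-trans (≈-reflexive (trans (cong (λ r → + pLe k r) (sym (m<n⇒m%n≡m 1≤π)))
                               (trans (cong periodic (sym (ℤ.+-inverseˡ (+ π)))) (periodic-+π (- + π)))))
                  (periodic-vanishes 1≤π (ℕ.≰⇒> T≰π))

triangle-positive : ∀ {k} → 1 ≤ k → 1 ≤ triangle k
triangle-positive {suc k} _ = s≤s z≤n

pLe-one : ∀ a → pLe 1 a ≡ 1
pLe-one zero    = refl
pLe-one (suc a) = trans (pLe-suc 0 (suc a)) (pLe-one a)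

-- p_{≤k}(a) = p_{≤k+1}(a) - p_{≤k+1}(a - k - 1), and the periodic extension of p_{≤k+1}
-- agrees with it modulo N down to -T.
IsPeriod-pred : ∀ {N k p} .{{_ : NonZero N}} .{{_ : NonZero p}} → 1 ≤ k →
                IsPeriod N (suc k) p → IsPeriod N k p
IsPeriod-pred {N} {k} {p} 1≤k per a = ≈⇒%-≡ (begin
  p≤ k (+ (a + p))
    ≡⟨ p≤-Δ k (+ (a + p)) ⟩
  p≤ (suc k) (+ (a + p)) -ℤ p≤ (suc k) (+ (a + p) -ℤ + suc k)
    ≈⟨ -ℤ-cong (periodic≈p≤ (a + p)) (periodic≈p≤-shifted (a + p) (suc k) (below (a + p))) ⟨
  periodic (+ (a + p)) -ℤ periodic (+ (a + p) -ℤ + suc k)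
    ≡⟨ cong₂ _-ℤ_ (periodic-+π (+ a))
                  (trans (cong periodic (lemma (+ a) (+ p) (+ suc k))) (periodic-+π (+ a -ℤ + suc k))) ⟩
  periodic (+ a) -ℤ periodic (+ a -ℤ + suc k)
    ≈⟨ -ℤ-cong (periodic≈p≤ a) (periodic≈p≤-shifted a (suc k) (below a)) ⟩
  p≤ (suc k) (+ a) -ℤ p≤ (suc k) (+ a -ℤ + suc k)
    ≡⟨ p≤-Δ k (+ a) ⟨
  p≤ k (+ a)
    ∎)
  where
  open Congruence N
  open ≈-Reasoning
  open PeriodicExtension N (suc k) p per
  lemma : ∀ a p c → (a +ℤ p) -ℤ c ≡ (a -ℤ c) +ℤ p
  lemma = solve-∀
  below : ∀ b → suc k < b + triangle (suc k)
  below b = ℕ.≤-trans (ℕ.≤-reflexive (ℕ.+-comm 1 (suc k)))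
                      (ℕ.≤-trans (ℕ.+-monoʳ-≤ (suc k) (triangle-positive 1≤k)) (ℕ.m≤n+m _ b))

box-vanishesMod : ∀ N .{{_ : NonZero N}} k π .{{_ : NonZero π}} → IsPeriod N k π →
  ∀ {n m a i} → π ∣ n → m * n ≤ a → a < suc m * n → π ∣ a + i → 1 ≤ i → i + topSum k m < triangle k →
  N ∣ box k n a
box-vanishesMod N k π per {n} {m} {a} {i} π∣n mn≤a a<mn+n π∣a+i 1≤i i+S<T = ≈0⇒∣ (begin
  + box k n a                                            ≡⟨ box≗∇p≤ k n (+ a) ⟩
  ∇ n k (p≤ k) (+ a)                                     ≡⟨ ∇-split (suc m) n k (p≤ k) (+ a) ⟩
  ∇< (suc m) n k (p≤ k) (+ a) +ℤ ∇≥ (suc m) n k (p≤ k) (+ a)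
    ≡⟨ cong (_+ℤ_ (∇< (suc m) n k (p≤ k) (+ a))) (∇≥-vanish (suc m) n k (p≤ k) (+ a) pastSection) ⟩
  ∇< (suc m) n k (p≤ k) (+ a) +ℤ + 0                     ≡⟨ ℤ.+-identityʳ _ ⟩
  ∇< (suc m) n k (p≤ k) (+ a)                            ≈⟨ ∇<-window m n k (p≤ k) periodic (+ a) nearA ⟩
  ∇< (suc m) n k periodic (+ a)
    ≡⟨ ∇<-dropPeriod (suc m) n k periodic (periodic--∣ π∣n) (+ a) ⟩
  ∇< (suc m) 0 k periodic (+ a)                          ≡⟨ cong (∇< (suc m) 0 k periodic) (lemma (+ a) (+ i)) ⟩
  ∇< (suc m) 0 k periodic (- + i +ℤ + (a + i))
    ≡⟨ ∇<-periodic (suc m) 0 k periodic _ (periodic-+∣ π∣a+i) (- + i) ⟩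
  ∇< (suc m) 0 k periodic (- + i)                        ≈⟨ ∇<-window m 0 k periodic (λ _ → + 0) (- + i) below-i ⟩
  ∇< (suc m) 0 k (λ _ → + 0) (- + i)                     ≡⟨ ∇<-zero (suc m) 0 k (- + i) ⟩
  + 0                                                    ∎)
  where
  open Congruence N
  open ≈-Reasoning
  open PeriodicExtension N k π per
  lemma : ∀ a i → a ≡ - i +ℤ (a +ℤ i)
  lemma = solve-∀
  S<T : topSum k m < triangle k
  S<T = ℕ.<-≤-trans (s≤s (ℕ.m≤n+m _ i)) i+S<T
  pastSection : ∀ j → p≤ k (+ a -ℤ + (suc m * n + j)) ≡ + 0
  pastSection j = p≤-below k (ℕ.<-≤-trans a<mn+n (ℕ.m≤m+n _ j))
  nearA : ∀ j → j ≤ m * n + topSum k m → p≤ k (+ a -ℤ + j) ≈ periodic (+ a -ℤ + j)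
  nearA j j≤ = ≈-sym (periodic≈p≤-shifted a j
    (ℕ.≤-<-trans (ℕ.≤-trans j≤ (ℕ.+-monoˡ-≤ _ mn≤a)) (ℕ.+-monoʳ-< a S<T)))
  below-i : ∀ j → j ≤ m * 0 + topSum k m → periodic (- + i -ℤ + j) ≈ + 0
  below-i j j≤ = ≈-at periodic (λ _ → + 0) (-+-ℤ+ i j)
    (periodic-vanishes (ℕ.≤-trans 1≤i (ℕ.m≤m+n i j))
      (ℕ.≤-<-trans (ℕ.+-monoʳ-≤ i (subst (j ≤_) (cong (_+ topSum k m) (ℕ.*-zeroʳ m)) j≤)) i+S<T))

nonnegative-offset : ∀ {Q c} r → c ≤ Q → + (Q + 1) ≤ℤ r +ℤ + c → r +ℤ + 1 ≤ℤ + Q →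
                     ∃[ ρ ] r ≡ + ρ × ρ < Q × Q < ρ + c
nonnegative-offset {Q} {c} (+ ρ) _ lower upper =
  ρ , refl , subst (_≤ Q) (ℕ.+-comm ρ 1) (ℤ.drop‿+≤+ upper)
           , subst (_≤ ρ + c) (ℕ.+-comm Q 1) (ℤ.drop‿+≤+ lower)
nonnegative-offset {Q} {c} -[1+ ρ ] c≤Q lower _ =
  ⊥-elim (ℕ.<⇒≱ (subst (_≤ c) (ℕ.+-comm Q 1) (ℤ.drop‿+≤+ (ℤ.≤-trans lower (ℤ.m⊖n≤m c (suc ρ)))))
                c≤Q)

section-position : ∀ {Q l t ρ} m → 1 ≤ l → t ≤ l ∸ 1 → ρ < Q →
  let a = m * (Q * l) + t * Q + ρ in
  m * (Q * l) ≤ a × a < suc m * (Q * l) × a + (Q ∸ ρ) ≡ (m * l + suc t) * Q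
section-position {Q} {l} {t} {ρ} m 1≤l t≤l-1 ρ<Q =
  ℕ.≤-trans (ℕ.m≤m+n _ (t * Q)) (ℕ.m≤m+n _ ρ) ,
  ℕ.≤-trans (ℕ.≤-reflexive (cong suc (ℕ.+-assoc (m * n) (t * Q) ρ)))
            (ℕ.≤-trans (ℕ.+-monoʳ-< (m * n) inBlock) (ℕ.≤-reflexive (ℕ.+-comm (m * n) n))) ,
  (begin
    m * n + t * Q + ρ + (Q ∸ ρ)      ≡⟨ ℕ.+-assoc (m * n + t * Q) ρ _ ⟩
    m * n + t * Q + (ρ + (Q ∸ ρ))    ≡⟨ cong (_+_ (m * n + t * Q)) (ℕ.m+[n∸m]≡n (ℕ.<⇒≤ ρ<Q)) ⟩
    m * (Q * l) + t * Q + Q          ≡⟨ lemma m Q l t ⟩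
    (m * l + suc t) * Q              ∎)
  where
  open ≡-Reasoning
  n = Q * l
  lemma : ∀ m Q l t → m * (Q * l) + t * Q + Q ≡ (m * l + suc t) * Q
  lemma = solve-∀ℕ
  t<l : suc t ≤ l
  t<l = ℕ.≤-trans (s≤s t≤l-1) (ℕ.≤-reflexive (ℕ.suc-pred l {{ℕ.>-nonZero 1≤l}}))
  inBlock : t * Q + ρ < n
  inBlock = ℕ.≤-trans (ℕ.+-monoʳ-< (t * Q) ρ<Q)
    (ℕ.≤-trans (ℕ.≤-reflexive (ℕ.+-comm (t * Q) Q))
               (ℕ.≤-trans (ℕ.*-monoˡ-≤ Q t<l) (ℕ.≤-reflexive (ℕ.*-comm l Q))))

if-preserves : ∀ (P : ℕ → Set) b {x y} → P x → P y → P (if b then x else y)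
if-preserves P true  Px _  = Px
if-preserves P false _  Py = Py

quot-* : ∀ {m d} → 1 ≤ d → d ∣ m → quot m d * d ≡ m
quot-* {d = suc _} _ d∣m = m/n*n≡m d∣m

module MinimalPeriods (N : ℕ) .{{_ : NonZero N}} (π : ℕ → ℕ)
                      (isMin : ∀ k → 1 ≤ k → IsMinPeriod N k (π k)) where

  π-positive : ∀ {k} → 1 ≤ k → 1 ≤ π k
  π-positive {k} 1≤k = proj₁ (isMin k 1≤k)

  π∣π-suc : ∀ k → 1 ≤ k → π k ∣ π (suc k)
  π∣π-suc k 1≤k = IsMinPeriod⇒∣ (isMin k 1≤k) (IsPeriod-pred 1≤k per-suc)
    where
    instance
      _ : NonZero (π (suc k))
      _ = ℕ.>-nonZero (π-positive (s≤s z≤n))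
    per-suc : IsPeriod N (suc k) (π (suc k))
    per-suc = proj₁ (proj₂ (isMin (suc k) (s≤s z≤n)))

  quot-π : ∀ k → quot (π (2 + k)) (π (suc k)) * π (suc k) ≡ π (2 + k)
  quot-π k = quot-* (π-positive (s≤s z≤n)) (π∣π-suc (suc k) (s≤s z≤n))

  π∣π′-suc : ∀ k → π (suc k) ∣ π′ N π (suc k) → π (2 + k) ∣ π′ N π (2 + k)
  π∣π′-suc k π∣π′ =
    if-preserves (π (2 + k) ∣_) (⌊ N ℕ∣.∣? ρ ⌋) π∣ρπ′
      (subst (π (2 + k) ∣_) (sym (ℕ.*-assoc N ρ _)) (ℕ∣.∣-trans π∣ρπ′ (ℕ∣.n∣m*n N)))
    where
    ρ = quot (π (2 + k)) (π (suc k))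
    π∣ρπ′ : π (2 + k) ∣ ρ * π′ N π (suc k)
    π∣ρπ′ = subst (_∣ ρ * π′ N π (suc k)) (quot-π k) (ℕ∣.*-monoʳ-∣ ρ π∣π′)

  π∣π′ : ∀ k → 1 ≤ k → π k ∣ π′ N π k
  π∣π′ (suc zero)    _ =
    IsMinPeriod⇒∣ (isMin 1 (s≤s z≤n)) (λ a → cong (_% N) (trans (pLe-one (a + 1)) (sym (pLe-one a))))
  π∣π′ (suc (suc k)) _ = π∣π′-suc k (π∣π′ (suc k) (s≤s z≤n))

  π-isPeriod : ∀ {k} → 1 ≤ k → IsPeriod N k (π k)
  π-isPeriod {k} 1≤k = proj₁ (proj₂ (isMin k 1≤k))

  π′-positive : ∀ k → 1 ≤ π′ N π k
  π′-positive zero          = s≤s z≤n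
  π′-positive (suc zero)    = s≤s z≤n
  π′-positive (suc (suc k)) = if-preserves (1 ≤_) (⌊ N ℕ∣.∣? ρ ⌋) (ℕ.*-mono-≤ 1≤ρ (π′-positive (suc k)))
    (ℕ.*-mono-≤ (ℕ.*-mono-≤ (ℕ.>-nonZero⁻¹ N) 1≤ρ) (π′-positive (suc k)))
    where
    ρ = quot (π (2 + k)) (π (suc k))
    1≤ρ : 1 ≤ ρ
    1≤ρ = ℕ.n≢0⇒n>0 (λ ρ≡0 → ℕ.<⇒≢ (π-positive (s≤s z≤n))
            (sym (trans (sym (quot-π k)) (cong (_* π (suc k)) ρ≡0))))

  triangle≤π′ : 2 ≤ N → ∀ {k} → 1 ≤ k → triangle k ≤ π′ N π k
  triangle≤π′ 2≤N {k} 1≤k = ℕ.≤-trans (triangle≤period 2≤N)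
    (ℕ∣.∣⇒≤ {{ℕ.>-nonZero (π′-positive k)}} (π∣π′ k 1≤k))
    where
    instance
      _ : NonZero (π k)
      _ = ℕ.>-nonZero (π-positive 1≤k)
    open PeriodicExtension N k (π k) (π-isPeriod 1≤k)

  C≤π′ : 2 ≤ N → ∀ {k m} → 1 ≤ k → m ≤ k → (k + 1 ∸ m) C 2 ≤ π′ N π k
  C≤π′ 2≤N {k} {m} 1≤k m≤k = ℕ.≤-trans (C≤triangle k m m≤k) (triangle≤π′ 2≤N 1≤k)

  blockTail-vanishesMod : ∀ {k l m t ρ} → 1 ≤ k → 1 ≤ l → m ≤ k → t ≤ l ∸ 1 →
    ρ < π′ N π k → π′ N π k < ρ + (k + 1 ∸ m) C 2 →
    N ∣ box k (π′ N π k * l) (m * (π′ N π k * l) + t * π′ N π k + ρ)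
  blockTail-vanishesMod {k} {l} {m} {t} {ρ} 1≤k 1≤l m≤k t≤l-1 ρ<Q Q<ρ+C
    with section-position m 1≤l t≤l-1 ρ<Q
  ... | inSection , beforeNext , a+i≡ =
    box-vanishesMod N k (π k) (π-isPeriod 1≤k) (ℕ∣.∣-trans π∣Q (ℕ∣.m∣m*n l)) inSection beforeNext
      (subst (π k ∣_) (sym a+i≡) (ℕ∣.∣-trans π∣Q (ℕ∣.n∣m*n (m * l + suc t)))) (ℕ.m<n⇒0<n∸m ρ<Q)
      (∸+topSum<triangle k m m≤k (ℕ.<⇒≤ ρ<Q) Q<ρ+C)
    where
    instance
      _ : NonZero (π k)
      _ = ℕ.>-nonZero (π-positive 1≤k)
    π∣Q = π∣π′ k 1≤k

corollary4p4 : (N : ℕ) .{{_ : NonZero N}} (π : ℕ → ℕ)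
    → (∀ k → 1 ≤ k → IsMinPeriod N k (π k))
    → (k l : ℕ) → 1 ≤ k → 1 ≤ l
    → (G : Series) → IsGaussian (π′ N π k * l + k) k G
    → (m t : ℕ) → m ≤ k ∸ 1 → t ≤ l ∸ 1
    → (r : ℤ)
    → + (π′ N π k + 1) ≤ℤ r +ℤ + ((k + 1 ∸ m) C 2)
    → r +ℤ + 1 ≤ℤ + π′ N π k
    → (a : ℕ) → + a ≡ + (m * (π′ N π k * l) + t * π′ N π k) +ℤ r
    → N ∣ G a
corollary4p4 N π isMin k l 1≤k 1≤l G isGaussian m t m≤k-1 t≤l-1 r lower upper a a≡ =
  subst (N ∣_) (sym (IsGaussian⇒box k n G isGaussian a)) (byModulus (N ≤? 1))
  where
  open MinimalPeriods N π isMin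
  Q = π′ N π k
  n = Q * l
  m≤k : m ≤ k
  m≤k = ℕ.≤-trans m≤k-1 (ℕ.m∸n≤m k 1)
  byModulus : Dec (N ≤ 1) → N ∣ box k n a
  byModulus (yes N≤1) = subst (_∣ box k n a) (ℕ.≤-antisym (ℕ.>-nonZero⁻¹ N) N≤1) (ℕ∣.1∣ box k n a)
  byModulus (no  N≰1) with nonnegative-offset r (C≤π′ (ℕ.≰⇒> N≰1) 1≤k m≤k) lower upper
  ... | ρ , r≡ρ , ρ<Q , Q<ρ+C =
    subst (λ b → N ∣ box k n b) (sym (ℤ.+-injective (trans a≡ (cong (+ (m * n + t * Q) +ℤ_) r≡ρ))))
      (blockTail-vanishesMod 1≤k 1≤l m≤k t≤l-1 ρ<Q Q<ρ+C)
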